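{- Let $m,k\ge 1$ and $q\ge 2$. For every linear multi de Bruijn sequence $s'\in\mathcal{L}(m,q,k)$, the first $(k-1)$-mer of $s'$ (its first $k-1$ letters) equals the last $(k-1)$-mer of $s'$ (its last $k-1$ letters).
   Context: Let $\Omega$ be an alphabet of size $q$; a $k$-mer is an element of $\Omega^k$. A linear multi de Bruijn sequence with parameters $(m,q,k)$ is a linear sequence of length $mq^k+k-1$ over $\Omega$ in which every $k$-mer occurs exactly $m$ times as a block of consecutive letters (no wrap-around). $\mathcal{L}(m,q,k)$ denotes the set of these. -}

module Defs where

open import Data.Nat using (ℕ; zero; suc; _+_; _*_; _∸_; _^_; _<?_)
open import Data.Fin using (Fin)
open import Data.List using (List; []; _∷_; length; take; drop; filter)
open import Data.Vec using (Vec; toList)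
open import Data.Product using (_×_)
open import Relation.Binary.PropositionalEquality using (_≡_)
open import Relation.Nullary using (yes; no)
open import Data.List.Properties using (≡-dec)
import Data.Fin.Properties as FinP

-- All length-k blocks of consecutive letters of s, one per starting
-- position i with 0 ≤ i ≤ length s ∸ k (linear: no wrap-around).
windows : {A : Set} → ℕ → List A → List (List A)
windows k [] with k
... | zero  = [] ∷ []
... | suc _ = []
windows k (x ∷ s) with length (x ∷ s) <? k
... | yes _ = []
... | no _  = take k (x ∷ s) ∷ windows k s

occ : {q : ℕ} → List (Fin q) → List (Fin q) → ℕ
occ w s = length (filter (λ u → ≡-dec FinP._≟_ u w) (windows (length w) s))

IsLinearMultiDeBruijn : (m q k : ℕ) → List (Fin q) → Set
IsLinearMultiDeBruijn m q k s =
  (length s ≡ m * q ^ k + (k ∸ 1)) ×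
  ((w : Vec (Fin q) k) → occ (toList w) s ≡ m)

-- Write n = k - 1 and let v be the first n-mer of s.  Count the occurrences
-- of v in s in two ways, by extending every occurrence by one letter:
--
--   * to the left: every occurrence of v except the one at position 0 is the
--     tail of an occurrence of some (n+1)-mer a ∷ v, so
--       occ v s = [first n-mer = v] + Σ_a occ (a ∷ v) s ;
--   * to the right: every occurrence of v except the one at the very end is
--     the head of an occurrence of some (n+1)-mer v ∷ʳ a, so
--       occ v s = Σ_a occ (v ∷ʳ a) s + [last n-mer = v] .
--
-- In a sequence of 𝓛(m,q,n+1) all (n+1)-mers occur m times, so both sums are
-- q·m; as [first n-mer = v] = 1 this forces [last n-mer = v] = 1.
module Submission where

open import Defs
open import Data.Nat using (ℕ; zero; suc; _≤_; _<_; _∸_; _+_; _<?_; _≤?_; s≤s)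
open import Data.Nat.Properties
  using (+-comm; +-cancelˡ-≡; suc-injective; m≤n+m; n≤1+n; m≤n⇒m⊓n≡m;
         +-∸-assoc; m≤n⇒m∸n≡0; <⇒≱; ≮⇒≥; ≰⇒>; +-0-commutativeMonoid)
open import Data.Fin using (Fin) renaming (zero to fzero; suc to fsuc)
import Data.Fin.Properties as FinP
open import Data.List using (List; []; _∷_; _++_; _∷ʳ_; [_]; take; drop; length; filter; map)
open import Data.List.Properties
  using (≡-dec; length-take; length-++; take-take; take-all; filter-++; ∷-injective; ∷ʳ-injectiveʳ)
open import Data.List.Relation.Unary.All using (All; []; _∷_)
open import Data.Vec using (fromList)
open import Data.Vec.Properties using (toList∘fromList)
open import Data.Product using (_,_; ∃-syntax; proj₁; proj₂)
open import Data.Empty using (⊥-elim)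
open import Function using (_∘_)
open import Level using (Level)
open import Function.Definitions using (Injective)
open import Relation.Binary.Definitions using (DecidableEquality)
open import Relation.Binary.PropositionalEquality using (_≡_; refl; sym; trans; cong; cong₂; subst; module ≡-Reasoning)
open import Relation.Nullary using (Dec; yes; no; ¬_)
open import Relation.Unary using (Pred; Decidable)
open import Algebra.Properties.CommutativeMonoid.Sum +-0-commutativeMonoid
  using (sum-syntax; ∑-distrib-+; sum-cong-≗; sum-replicate-zero)

private
  variable
    a p : Level
    A B : Set a

𝟙 : {P : Set p} → Dec P → ℕ
𝟙 (yes _) = 1
𝟙 (no _)  = 0

𝟙-yes : {P : Set p} → P → (d : Dec P) → 𝟙 d ≡ 1
𝟙-yes _  (yes _) = refl
𝟙-yes px (no ¬p) = ⊥-elim (¬p px)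

𝟙-no : {P : Set p} → ¬ P → (d : Dec P) → 𝟙 d ≡ 0
𝟙-no ¬p (yes px) = ⊥-elim (¬p px)
𝟙-no _  (no _)   = refl

𝟙≡1⇒ : {P : Set p} (d : Dec P) → 𝟙 d ≡ 1 → P
𝟙≡1⇒ (yes px) _ = px

∑-zero : ∀ {q} (f : Fin q → ℕ) → (∀ i → f i ≡ 0) → ∑[ i < q ] f i ≡ 0
∑-zero {q} f f≡0 = trans (sum-cong-≗ f≡0) (sum-replicate-zero q)

count : {P : Pred A p} → Decidable P → List A → ℕ
count P? xs = length (filter P? xs)

count-cons : {P : Pred A p} (P? : Decidable P) (x : A) (xs : List A) →
             count P? (x ∷ xs) ≡ 𝟙 (P? x) + count P? xs
count-cons P? x xs with P? x
... | yes _ = refl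
... | no _  = refl

count-++ : {P : Pred A p} (P? : Decidable P) (xs ys : List A) →
           count P? (xs ++ ys) ≡ count P? xs + count P? ys
count-++ P? xs ys = trans (cong length (filter-++ P? xs ys)) (length-++ (filter P? xs))

count-map : {P : Pred B p} (P? : Decidable P) (f : A → B) (xs : List A) →
            count P? (map f xs) ≡ count (P? ∘ f) xs
count-map P? f [] = refl
count-map P? f (x ∷ xs) with P? (f x)
... | yes _ = cong suc (count-map P? f xs)
... | no _  = count-map P? f xs

count-∑ : ∀ {q ℓ ℓ′} {P : Pred A ℓ} {Q : Fin q → Pred A ℓ′}
          (P? : Decidable P) (Q? : (i : Fin q) → Decidable (Q i)) (xs : List A) →
          All (λ x → 𝟙 (P? x) ≡ ∑[ i < q ] 𝟙 (Q? i x)) xs →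
          count P? xs ≡ ∑[ i < q ] count (Q? i) xs
count-∑ {q = q} P? Q? [] [] = sym (∑-zero {q} (λ _ → 0) (λ _ → refl))
count-∑ {q = q} P? Q? (x ∷ xs) (px ∷ pxs) = begin
  count P? (x ∷ xs)                                   ≡⟨ count-cons P? x xs ⟩
  𝟙 (P? x) + count P? xs                              ≡⟨ cong₂ _+_ px (count-∑ P? Q? xs pxs) ⟩
  ∑[ i < q ] 𝟙 (Q? i x) + ∑[ i < q ] count (Q? i) xs  ≡⟨ sym (∑-distrib-+ {q} _ _) ⟩
  ∑[ i < q ] (𝟙 (Q? i x) + count (Q? i) xs)           ≡⟨ sum-cong-≗ (λ i → sym (count-cons (Q? i) x xs)) ⟩
  ∑[ i < q ] count (Q? i) (x ∷ xs)                    ∎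
  where open ≡-Reasoning

∑-𝟙-injective : ∀ {q} (_≟_ : DecidableEquality B) (g : Fin q → B) → Injective _≡_ _≡_ g →
                (b : Fin q) → ∑[ i < q ] 𝟙 (g b ≟ g i) ≡ 1
∑-𝟙-injective _≟_ g inj fzero = cong₂ _+_ (𝟙-yes refl (g fzero ≟ g fzero))
  (∑-zero _ (λ i → 𝟙-no (zero≢suc ∘ inj) (g fzero ≟ g (fsuc i))))
  where zero≢suc : ∀ {i} → ¬ fzero ≡ fsuc i
        zero≢suc ()
∑-𝟙-injective _≟_ g inj (fsuc b) = cong₂ _+_ (𝟙-no (suc≢zero ∘ inj) (g (fsuc b) ≟ g fzero))
  (∑-𝟙-injective _≟_ (g ∘ fsuc) (FinP.suc-injective ∘ inj) b)
  where suc≢zero : ∀ {i} → ¬ fsuc i ≡ fzero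
        suc≢zero ()

𝟙-fibre : ∀ {q} (_≟_ : DecidableEquality B) (g : Fin q → B) → Injective _≡_ _≡_ g →
          {P : Set p} (P? : Dec P) (x : B) →
          (P → ∃[ i ] x ≡ g i) → (∀ i → x ≡ g i → P) →
          𝟙 P? ≡ ∑[ i < q ] 𝟙 (x ≟ g i)
𝟙-fibre _≟_ g inj (yes px) x onImage _ with onImage px
... | b , refl = sym (∑-𝟙-injective _≟_ g inj b)
𝟙-fibre _≟_ g inj (no ¬px) x _ fromImage =
  sym (∑-zero _ (λ i → 𝟙-no (¬px ∘ fromImage i) (x ≟ g i)))

module _ {A : Set} where

  windows-short : ∀ n (s : List A) → length s < n → windows n s ≡ []
  windows-short (suc n) []      _ = refl
  windows-short n       (x ∷ s) lt with length (x ∷ s) <? n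
  ... | yes _  = refl
  ... | no ¬lt = ⊥-elim (¬lt lt)

  windows-cons : ∀ n (x : A) s → n ≤ suc (length s) →
                 windows n (x ∷ s) ≡ take n (x ∷ s) ∷ windows n s
  windows-cons n x s le with length (x ∷ s) <? n
  ... | yes lt = ⊥-elim (<⇒≱ lt le)
  ... | no _   = refl

  windows-length : ∀ n (s : List A) → All (λ w → length w ≡ n) (windows n s)
  windows-length zero    []      = refl ∷ []
  windows-length (suc n) []      = []
  windows-length n       (x ∷ s) with length (x ∷ s) <? n
  ... | yes _  = []
  ... | no ¬lt = trans (length-take n (x ∷ s)) (m≤n⇒m⊓n≡m (≮⇒≥ ¬lt)) ∷ windows-length n s

  windows-tails : ∀ n (s : List A) → n ≤ length s →
                  windows n s ≡ take n s ∷ map (drop 1) (windows (suc n) s)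
  windows-tails zero [] _ = refl
  windows-tails n (x ∷ s) le with n ≤? length s
  ... | yes le′ rewrite windows-cons n x s le | windows-cons (suc n) x s (s≤s le′)
                      | windows-tails n s le′ = refl
  ... | no ¬le rewrite windows-cons n x s le | windows-short n s (≰⇒> ¬le)
                     | windows-short (suc n) (x ∷ s) (s≤s (≰⇒> ¬le)) = refl

  windows-heads : ∀ n (s : List A) → n ≤ length s →
                  windows n s ≡ map (take n) (windows (suc n) s) ∷ʳ drop (length s ∸ n) s
  windows-heads zero [] _ = refl
  windows-heads n (x ∷ s) le with n ≤? length s
  ... | yes le′ rewrite windows-cons n x s le | windows-cons (suc n) x s (s≤s le′)
                      | windows-heads n s le′ | +-∸-assoc 1 le′ =
        cong (_∷ _) (sym take-n∘take-suc-n)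
    where
    take-n∘take-suc-n : take n (take (suc n) (x ∷ s)) ≡ take n (x ∷ s)
    take-n∘take-suc-n = trans (take-take n (suc n) (x ∷ s))
                              (cong (λ i → take i (x ∷ s)) (m≤n⇒m⊓n≡m (n≤1+n n)))
  ... | no ¬le rewrite windows-cons n x s le | windows-short n s (≰⇒> ¬le)
                     | windows-short (suc n) (x ∷ s) (s≤s (≰⇒> ¬le))
                     | m≤n⇒m∸n≡0 (≰⇒> ¬le) = cong [_] (take-all n (x ∷ s) (≰⇒> ¬le))

snoc-view : ∀ n (w : List A) → length w ≡ suc n → ∃[ x ] w ≡ take n w ∷ʳ x
snoc-view zero    (x ∷ []) _   = x , refl
snoc-view (suc n) (y ∷ w)  len = proj₁ ih , cong (y ∷_) (proj₂ ih)
  where ih : ∃[ x ] w ≡ take n w ∷ʳ x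
        ih = snoc-view n w (suc-injective len)

take-∷ʳ : ∀ (v : List A) x → take (length v) (v ∷ʳ x) ≡ v
take-∷ʳ []      x = refl
take-∷ʳ (y ∷ v) x = cong (y ∷_) (take-∷ʳ v x)

length-∷ʳ : ∀ (v : List A) x → length (v ∷ʳ x) ≡ suc (length v)
length-∷ʳ v x = trans (length-++ v) (+-comm (length v) 1)

module Words {q : ℕ} where

  Word : Set
  Word = List (Fin q)

  infix 4 _≟_
  _≟_ : DecidableEquality Word
  _≟_ = ≡-dec FinP._≟_

  count-prefix : ∀ n (v : Word) (ws : List Word) → length v ≡ n →
                 All (λ w → length w ≡ suc n) ws →
                 count (λ w → take n w ≟ v) ws ≡ ∑[ a < q ] count (_≟ v ∷ʳ a) ws
  count-prefix n v ws refl lengths =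
    count-∑ (λ w → take n w ≟ v) (λ a w → w ≟ v ∷ʳ a) ws (pointwise lengths)
    where
    pointwise : ∀ {ws} → All (λ w → length w ≡ suc n) ws →
                All (λ w → 𝟙 (take n w ≟ v) ≡ ∑[ a < q ] 𝟙 (w ≟ v ∷ʳ a)) ws
    pointwise [] = []
    pointwise {w ∷ _} (len ∷ lens) =
      𝟙-fibre _≟_ (v ∷ʳ_) (∷ʳ-injectiveʳ v v) (take n w ≟ v) w
        (λ prefix → subst (λ u → ∃[ a ] w ≡ u ∷ʳ a) prefix (snoc-view n w len))
        (λ { a refl → take-∷ʳ v a })
      ∷ pointwise lens

  count-suffix : ∀ n (v : Word) (ws : List Word) →
                 All (λ w → length w ≡ suc n) ws →
                 count (λ w → drop 1 w ≟ v) ws ≡ ∑[ a < q ] count (_≟ a ∷ v) ws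
  count-suffix n v ws lengths =
    count-∑ (λ w → drop 1 w ≟ v) (λ a w → w ≟ a ∷ v) ws (pointwise lengths)
    where
    pointwise : ∀ {ws} → All (λ w → length w ≡ suc n) ws →
                All (λ w → 𝟙 (drop 1 w ≟ v) ≡ ∑[ a < q ] 𝟙 (w ≟ a ∷ v)) ws
    pointwise [] = []
    pointwise {(x ∷ w) ∷ _} (_ ∷ lens) =
      𝟙-fibre _≟_ (_∷ v) (proj₁ ∘ ∷-injective) (w ≟ v) (x ∷ w)
        (λ { refl → x , refl })
        (λ { a refl → refl })
      ∷ pointwise lens

  occ-at : ∀ (s u : Word) k → length u ≡ k → occ u s ≡ count (_≟ u) (windows k s)
  occ-at s u _ refl = refl

  occ-extend-left : ∀ n (s v : Word) → length v ≡ n → n ≤ length s →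
                    occ v s ≡ 𝟙 (take n s ≟ v) + ∑[ a < q ] occ (a ∷ v) s
  occ-extend-left n s v refl le = begin
    count (_≟ v) (windows n s)
      ≡⟨ cong (count (_≟ v)) (windows-tails n s le) ⟩
    count (_≟ v) (take n s ∷ map (drop 1) W)
      ≡⟨ count-cons (_≟ v) (take n s) _ ⟩
    𝟙 (take n s ≟ v) + count (_≟ v) (map (drop 1) W)
      ≡⟨ cong (𝟙 (take n s ≟ v) +_) (count-map (_≟ v) (drop 1) W) ⟩
    𝟙 (take n s ≟ v) + count (λ w → drop 1 w ≟ v) W
      ≡⟨ cong (𝟙 (take n s ≟ v) +_) (count-suffix n v W (windows-length (suc n) s)) ⟩
    𝟙 (take n s ≟ v) + ∑[ a < q ] occ (a ∷ v) s
      ∎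
    where open ≡-Reasoning
          W : List Word
          W = windows (suc n) s

  occ-extend-right : ∀ n (s v : Word) → length v ≡ n → n ≤ length s →
                     occ v s ≡ ∑[ a < q ] occ (v ∷ʳ a) s + 𝟙 (drop (length s ∸ n) s ≟ v)
  occ-extend-right n s v refl le = begin
    count (_≟ v) (windows n s)
      ≡⟨ cong (count (_≟ v)) (windows-heads n s le) ⟩
    count (_≟ v) (map (take n) W ∷ʳ last)
      ≡⟨ count-++ (_≟ v) (map (take n) W) [ last ] ⟩
    count (_≟ v) (map (take n) W) + count (_≟ v) [ last ]
      ≡⟨ cong₂ _+_ (count-map (_≟ v) (take n) W) (count-cons (_≟ v) last []) ⟩
    count (λ w → take n w ≟ v) W + (𝟙 (last ≟ v) + 0)
      ≡⟨ cong₂ _+_ (count-prefix n v W refl (windows-length (suc n) s)) (+-comm _ 0) ⟩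
    ∑[ a < q ] count (_≟ v ∷ʳ a) W + 𝟙 (last ≟ v)
      ≡⟨ cong (_+ 𝟙 (last ≟ v)) (sum-cong-≗ λ a →
           sym (occ-at s (v ∷ʳ a) (suc n) (length-∷ʳ v a))) ⟩
    ∑[ a < q ] occ (v ∷ʳ a) s + 𝟙 (last ≟ v)
      ∎
    where open ≡-Reasoning
          W : List Word
          W    = windows (suc n) s
          last : Word
          last = drop (length s ∸ n) s

open Words

occ-uniform : ∀ {m q k} (s : Word {q}) → IsLinearMultiDeBruijn m q k s →
              (u : Word {q}) → length u ≡ k → occ u s ≡ m
occ-uniform {m} s (_ , uniform) u refl =
  subst (λ w → occ w s ≡ m) (toList∘fromList u) (uniform (fromList u))

lemma2 : (m q k : ℕ) → 1 ≤ m → 2 ≤ q → 1 ≤ k →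
         (s : List (Fin q)) → IsLinearMultiDeBruijn m q k s →
         take (k ∸ 1) s ≡ drop (length s ∸ (k ∸ 1)) s
lemma2 m q zero    _ _ () s _
lemma2 m q (suc n) _ _ _  s db@(len , _) = sym (𝟙≡1⇒ (last ≟ first) last≡first)
  where
  first last : List (Fin q)
  first = take n s
  last  = drop (length s ∸ n) s
  n≤len : n ≤ length s
  n≤len = subst (n ≤_) (sym len) (m≤n+m n _)
  first-length : length first ≡ n
  first-length = trans (length-take n s) (m≤n⇒m⊓n≡m n≤len)
  from-left : occ first s ≡ 1 + ∑[ a < q ] m
  from-left = trans (occ-extend-left n s first first-length n≤len)
    (cong₂ _+_ (𝟙-yes refl (first ≟ first))
               (sum-cong-≗ (λ a → occ-uniform s db (a ∷ first) (cong suc first-length))))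
  from-right : occ first s ≡ ∑[ a < q ] m + 𝟙 (last ≟ first)
  from-right = trans (occ-extend-right n s first first-length n≤len)
    (cong (_+ 𝟙 (last ≟ first)) (sum-cong-≗ (λ a → occ-uniform s db (first ∷ʳ a)
                                      (trans (length-∷ʳ first a) (cong suc first-length)))))
  last≡first : 𝟙 (last ≟ first) ≡ 1
  last≡first = +-cancelˡ-≡ (∑[ a < q ] m) _ _
    (trans (sym from-right) (trans from-left (+-comm 1 _)))
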